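{- Let $L$ be a Boolean algebra with the change action $\hat L_{\bowtie}$, let $\hat A$ be a change action and $f:A\to L$ a function. Then $a\ominus_\bot b=(a\wedge\neg b,\neg a)$ and $a\ominus_\top b=(a,b\wedge\neg a)$ are difference operators for $\hat L_{\bowtie}$, and the functions $\partial f_{\ominus_\bot}(x,\delta)=f(x\oplus_A\delta)\ominus_\bot f(x)$ and $\partial f_{\ominus_\top}(x,\delta)=f(x\oplus_A\delta)\ominus_\top f(x)$ are respectively the unique least and unique greatest derivatives of $f$, i.e. every derivative $g$ of $f$ satisfies $\partial f_{\ominus_\bot}\le g\le\partial f_{\ominus_\top}$ pointwise with respect to the order $(p,q)\le(r,s)\iff p\le r\text{ and }q\ge s$ on $L\bowtie L$.
   Context: $\hat L_{\bowtie}$ is the change action with base $L$, change set $L\bowtie L=\{(p,q)\in L\times L\mid p\wedge q=\bot\}$, monoid operation $(p,q)\bowtie(r,s)=((p\wedge\neg s)\vee r,(q\wedge\neg r)\vee s)$ with identity $(\bot,\bot)$, and action $a\oplus_{\bowtie}(p,q)=(a\vee p)\wedge\neg q$. In general a change action $\hat A=(A,\Delta A,\oplus_A,+,0)$ is a set $A$, a monoid $(\Delta A,+,0)$ and a monoid action $\oplus_A:A\times\Delta A\to A$ ($a\oplus 0=a$, $a\oplus(\delta_1+\delta_2)=(a\oplus\delta_1)\oplus\delta_2$). A difference operator for $\hat L_{\bowtie}$ is $\ominus:L\times L\to L\bowtie L$ with $b\oplus_{\bowtie}(a\ominus b)=a$ for all $a,b$. A derivative of $f:A\to L$ is $\partial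 f:A\times\Delta A\to L\bowtie L$ with $f(x\oplus_A\delta)=f(x)\oplus_{\bowtie}\partial f(x,\delta)$ for all $x,\delta$. -}

module Defs where

open import Level using (Level; _⊔_)
open import Data.Product using (Σ; _×_; _,_; proj₁; proj₂)
open import Relation.Binary.PropositionalEquality using (_≡_)
open import Algebra.Lattice.Bundles using (BooleanAlgebra)
import Algebra.Lattice.Properties.BooleanAlgebra as BAProps
import Relation.Binary.Reasoning.Setoid as SetoidReasoning

record ChangeAction (a d : Level) : Set (Level.suc (a ⊔ d)) where
  infixl 6 _⊕_
  infixl 7 _+_
  field
    Base    : Set a
    Δ       : Set d
    _+_     : Δ → Δ → Δ
    𝟘       : Δ
    _⊕_     : Base → Δ → Base
    +-assoc     : ∀ x y z → (x + y) + z ≡ x + (y + z)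
    +-identityˡ : ∀ x → 𝟘 + x ≡ x
    +-identityʳ : ∀ x → x + 𝟘 ≡ x
    ⊕-identity  : ∀ x → x ⊕ 𝟘 ≡ x
    ⊕-action    : ∀ x δ₁ δ₂ → x ⊕ (δ₁ + δ₂) ≡ (x ⊕ δ₁) ⊕ δ₂

module Bowtie {c ℓ : Level} (L : BooleanAlgebra c ℓ) where
  open BooleanAlgebra L
  open BAProps L using (∧-zeroˡ)

  _≤L_ : Carrier → Carrier → Set ℓ
  x ≤L y = x ∧ y ≈ x

  L⋈L : Set (c ⊔ ℓ)
  L⋈L = Σ (Carrier × Carrier) (λ pq → proj₁ pq ∧ proj₂ pq ≈ ⊥)

  fst snd : L⋈L → Carrier
  fst d = proj₁ (proj₁ d)
  snd d = proj₂ (proj₁ d)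

  _⋈_ : Carrier × Carrier → Carrier × Carrier → Carrier × Carrier
  (p , q) ⋈ (r , s) = ((p ∧ ¬ s) ∨ r) , ((q ∧ ¬ r) ∨ s)

  _⊕⋈_ : Carrier → L⋈L → Carrier
  a ⊕⋈ d = (a ∨ fst d) ∧ ¬ snd d

  _≤⋈_ : L⋈L → L⋈L → Set ℓ
  d ≤⋈ e = (fst d ≤L fst e) × (snd e ≤L snd d)

  IsDifferenceOperator : (Carrier → Carrier → L⋈L) → Set (c ⊔ ℓ)
  IsDifferenceOperator _⊖_ = ∀ a b → b ⊕⋈ (a ⊖ b) ≈ a

  private
    open SetoidReasoning setoid
    disj⊥ : ∀ a b → (a ∧ ¬ b) ∧ ¬ a ≈ ⊥
    disj⊥ a b = begin
      (a ∧ ¬ b) ∧ ¬ a   ≈⟨ ∧-assoc a (¬ b) (¬ a) ⟩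
      a ∧ (¬ b ∧ ¬ a)   ≈⟨ ∧-congˡ (∧-comm (¬ b) (¬ a)) ⟩
      a ∧ (¬ a ∧ ¬ b)   ≈⟨ sym (∧-assoc a (¬ a) (¬ b)) ⟩
      (a ∧ ¬ a) ∧ ¬ b   ≈⟨ ∧-congʳ (∧-complementʳ a) ⟩
      ⊥ ∧ ¬ b           ≈⟨ ∧-zeroˡ (¬ b) ⟩
      ⊥ ∎
    disj⊤ : ∀ a b → a ∧ (b ∧ ¬ a) ≈ ⊥
    disj⊤ a b = begin
      a ∧ (b ∧ ¬ a)     ≈⟨ ∧-congˡ (∧-comm b (¬ a)) ⟩
      a ∧ (¬ a ∧ b)     ≈⟨ sym (∧-assoc a (¬ a) b) ⟩
      (a ∧ ¬ a) ∧ b     ≈⟨ ∧-congʳ (∧-complementʳ a) ⟩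
      ⊥ ∧ b             ≈⟨ ∧-zeroˡ b ⟩
      ⊥ ∎

  _⊖⊥_ : Carrier → Carrier → L⋈L
  a ⊖⊥ b = ((a ∧ ¬ b) , ¬ a) , disj⊥ a b

  _⊖⊤_ : Carrier → Carrier → L⋈L
  a ⊖⊤ b = (a , (b ∧ ¬ a)) , disj⊤ a b

  module _ {a d : Level} (Â : ChangeAction a d) where
    open ChangeAction Â using (Base; Δ; _⊕_)

    IsDerivative : (Base → Carrier) → (Base → Δ → L⋈L) → Set (a ⊔ d ⊔ ℓ)
    IsDerivative f ∂f = ∀ x δ → f (x ⊕ δ) ≈ f x ⊕⋈ ∂f x δ

    ∂⊥ : (Base → Carrier) → Base → Δ → L⋈L
    ∂⊥ f x δ = f (x ⊕ δ) ⊖⊥ f x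

    ∂⊤ : (Base → Carrier) → Base → Δ → L⋈L
    ∂⊤ f x δ = f (x ⊕ δ) ⊖⊤ f x

-- In b ⊕⋈ (p , q) = (b ∨ p) ∧ ¬ q the first component p is added to b and the
-- second component q removed. If this yields a, then p must contain everything a
-- gains over b and cannot exceed a, while q must contain everything b loses and
-- cannot meet a. So every solution d of b ⊕⋈ d ≈ a lies between a ⊖⊥ b and
-- a ⊖⊤ b, which are solutions themselves; taking a = f (x ⊕ δ) and b = f x gives
-- the least and greatest derivatives. The order bounds all come from the
-- residuation law x ∧ ¬ y ≤ z ⇔ x ≤ y ∨ z of a Boolean algebra.
module Submission where

open import Defs
open import Level using (Level)
open import Data.Product using (_×_; _,_)
open import Algebra.Lattice.Bundles using (BooleanAlgebra)
import Algebra.Lattice.Properties.BooleanAlgebra as BooleanAlgebraProperties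
import Algebra.Lattice.Properties.Lattice as LatticeProperties
import Relation.Binary.Lattice as OrderTheoretic
import Relation.Binary.Lattice.Properties.JoinSemilattice as JoinSemilatticeProperties
import Relation.Binary.Lattice.Properties.MeetSemilattice as MeetSemilatticeProperties
import Relation.Binary.Reasoning.PartialOrder as PartialOrderReasoning
import Relation.Binary.Reasoning.Setoid as SetoidReasoning

module BooleanAlgebraOrder {c ℓ : Level} (L : BooleanAlgebra c ℓ) where
  open BooleanAlgebra L
  open BooleanAlgebraProperties L using (∧-identityʳ; ∨-identityˡ; ∨-identityʳ; ¬-involutive)

  orderLattice : OrderTheoretic.Lattice c ℓ ℓ
  orderLattice = LatticeProperties.∨-∧-orderTheoreticLattice lattice

  open OrderTheoretic.Lattice orderLattice public
    using (_≤_; poset; x∧y≤x; x∧y≤y; x≤x∨y; y≤x∨y; ∧-greatest)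
    renaming (refl to ≤-refl; reflexive to ≤-reflexive)
  open OrderTheoretic.Lattice orderLattice using (meetSemilattice; joinSemilattice)
  open MeetSemilatticeProperties meetSemilattice public using (∧-monotonic)
  open JoinSemilatticeProperties joinSemilattice using (∨-monotonic)
  open PartialOrderReasoning poset

  -- The library orders by x ≈ x ∧ y, Defs by x ∧ y ≈ x.
  ≤⇒≤L : ∀ {x y} → x ≤ y → Bowtie._≤L_ L x y
  ≤⇒≤L = sym

  x≤y∨z⇒x∧¬y≤z : ∀ {x y z} → x ≤ y ∨ z → x ∧ ¬ y ≤ z
  x≤y∨z⇒x∧¬y≤z {x} {y} {z} x≤y∨z = begin
    x ∧ ¬ y               ≤⟨ ∧-monotonic x≤y∨z (≤-refl {¬ y}) ⟩
    (y ∨ z) ∧ ¬ y         ≈⟨ ∧-distribʳ-∨ (¬ y) y z ⟩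
    y ∧ ¬ y ∨ z ∧ ¬ y     ≈⟨ ∨-congʳ (∧-complementʳ y) ⟩
    ⊥ ∨ z ∧ ¬ y           ≈⟨ ∨-identityˡ (z ∧ ¬ y) ⟩
    z ∧ ¬ y               ≤⟨ x∧y≤x z (¬ y) ⟩
    z                     ∎

  x∧¬y≤z⇒x≤y∨z : ∀ {x y z} → x ∧ ¬ y ≤ z → x ≤ y ∨ z
  x∧¬y≤z⇒x≤y∨z {x} {y} {z} x∧¬y≤z = begin
    x                     ≈⟨ ∧-identityʳ x ⟨
    x ∧ ⊤                 ≈⟨ ∧-congˡ (∨-complementʳ y) ⟨
    x ∧ (y ∨ ¬ y)         ≈⟨ ∧-distribˡ-∨ x y (¬ y) ⟩
    x ∧ y ∨ x ∧ ¬ y       ≤⟨ ∨-monotonic (x∧y≤y x y) x∧¬y≤z ⟩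
    y ∨ z                 ∎

  x∧¬y≤z⇒x∧¬z≤y : ∀ {x y z} → x ∧ ¬ y ≤ z → x ∧ ¬ z ≤ y
  x∧¬y≤z⇒x∧¬z≤y {x} {y} {z} x∧¬y≤z = x≤y∨z⇒x∧¬y≤z (begin
    x                     ≤⟨ x∧¬y≤z⇒x≤y∨z x∧¬y≤z ⟩
    y ∨ z                 ≈⟨ ∨-comm y z ⟩
    z ∨ y                 ∎)

  x∧y≤⊥⇒x≤¬y : ∀ {x y} → x ∧ y ≤ ⊥ → x ≤ ¬ y
  x∧y≤⊥⇒x≤¬y {x} {y} x∧y≤⊥ = begin
    x                     ≤⟨ x∧¬y≤z⇒x≤y∨z x∧¬¬y≤⊥ ⟩
    ¬ y ∨ ⊥               ≈⟨ ∨-identityʳ (¬ y) ⟩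
    ¬ y                   ∎
    where
    x∧¬¬y≤⊥ : x ∧ ¬ ¬ y ≤ ⊥
    x∧¬¬y≤⊥ = begin
      x ∧ ¬ ¬ y           ≈⟨ ∧-congˡ (¬-involutive y) ⟩
      x ∧ y               ≤⟨ x∧y≤⊥ ⟩
      ⊥                   ∎

  x≤¬y⇒x∧y≤⊥ : ∀ {x y} → x ≤ ¬ y → x ∧ y ≤ ⊥
  x≤¬y⇒x∧y≤⊥ {x} {y} x≤¬y = begin
    x ∧ y                 ≈⟨ ∧-congˡ (¬-involutive y) ⟨
    x ∧ ¬ ¬ y             ≤⟨ x≤y∨z⇒x∧¬y≤z x≤¬y∨⊥ ⟩
    ⊥                     ∎
    where
    x≤¬y∨⊥ : x ≤ ¬ y ∨ ⊥
    x≤¬y∨⊥ = begin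
      x                   ≤⟨ x≤¬y ⟩
      ¬ y                 ≈⟨ ∨-identityʳ (¬ y) ⟨
      ¬ y ∨ ⊥             ∎

  x≤¬y⇒y≤¬x : ∀ {x y} → x ≤ ¬ y → y ≤ ¬ x
  x≤¬y⇒y≤¬x {x} {y} x≤¬y = x∧y≤⊥⇒x≤¬y (begin
    y ∧ x                 ≈⟨ ∧-comm y x ⟩
    x ∧ y                 ≤⟨ x≤¬y⇒x∧y≤⊥ x≤¬y ⟩
    ⊥                     ∎)

module BowtieDifferences {c ℓ : Level} (L : BooleanAlgebra c ℓ) where
  open BooleanAlgebra L
  open BooleanAlgebraProperties L using (∧-identityʳ; ∨-identityʳ; ¬-involutive; deMorgan₁)
  open Bowtie L
  open BooleanAlgebraOrder L

  ⊖⊥-isDifferenceOperator : IsDifferenceOperator _⊖⊥_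
  ⊖⊥-isDifferenceOperator a b = begin
    (b ∨ a ∧ ¬ b) ∧ ¬ ¬ a       ≈⟨ ∧-cong (∨-distribˡ-∧ b a (¬ b)) (¬-involutive a) ⟩
    ((b ∨ a) ∧ (b ∨ ¬ b)) ∧ a   ≈⟨ ∧-congʳ (∧-congˡ (∨-complementʳ b)) ⟩
    ((b ∨ a) ∧ ⊤) ∧ a           ≈⟨ ∧-congʳ (∧-identityʳ (b ∨ a)) ⟩
    (b ∨ a) ∧ a                 ≈⟨ ∧-comm (b ∨ a) a ⟩
    a ∧ (b ∨ a)                 ≈⟨ ∧-congˡ (∨-comm b a) ⟩
    a ∧ (a ∨ b)                 ≈⟨ ∧-absorbs-∨ a b ⟩
    a                           ∎
    where open SetoidReasoning setoid

  ⊖⊤-isDifferenceOperator : IsDifferenceOperator _⊖⊤_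
  ⊖⊤-isDifferenceOperator a b = begin
    (b ∨ a) ∧ ¬ (b ∧ ¬ a)       ≈⟨ ∧-cong (∨-comm b a) (deMorgan₁ b (¬ a)) ⟩
    (a ∨ b) ∧ (¬ b ∨ ¬ ¬ a)     ≈⟨ ∧-congˡ (∨-congˡ (¬-involutive a)) ⟩
    (a ∨ b) ∧ (¬ b ∨ a)         ≈⟨ ∧-congˡ (∨-comm (¬ b) a) ⟩
    (a ∨ b) ∧ (a ∨ ¬ b)         ≈⟨ ∨-distribˡ-∧ a b (¬ b) ⟨
    a ∨ b ∧ ¬ b                 ≈⟨ ∨-congˡ (∧-complementʳ b) ⟩
    a ∨ ⊥                       ≈⟨ ∨-identityʳ a ⟩
    a                           ∎
    where open SetoidReasoning setoid

  ⊖⊥-least : ∀ {a b} d → a ≈ b ⊕⋈ d → (a ⊖⊥ b) ≤⋈ d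
  ⊖⊥-least {a} {b} ((p , q) , _) a≈b⊕d = ≤⇒≤L a∧¬b≤p , ≤⇒≤L q≤¬a
    where
    open PartialOrderReasoning poset
    a∧¬b≤p : a ∧ ¬ b ≤ p
    a∧¬b≤p = x≤y∨z⇒x∧¬y≤z (begin
      a                   ≈⟨ a≈b⊕d ⟩
      (b ∨ p) ∧ ¬ q       ≤⟨ x∧y≤x (b ∨ p) (¬ q) ⟩
      b ∨ p               ∎)
    q≤¬a : q ≤ ¬ a
    q≤¬a = x≤¬y⇒y≤¬x (begin
      a                   ≈⟨ a≈b⊕d ⟩
      (b ∨ p) ∧ ¬ q       ≤⟨ x∧y≤y (b ∨ p) (¬ q) ⟩
      ¬ q                 ∎)

  ⊖⊤-greatest : ∀ {a b} d → a ≈ b ⊕⋈ d → d ≤⋈ (a ⊖⊤ b)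
  ⊖⊤-greatest {a} {b} ((p , q) , p∧q≈⊥) a≈b⊕d = ≤⇒≤L p≤a , ≤⇒≤L b∧¬a≤q
    where
    open PartialOrderReasoning poset
    p≤a : p ≤ a
    p≤a = begin
      p                   ≤⟨ ∧-greatest (y≤x∨y b p) (x∧y≤⊥⇒x≤¬y (≤-reflexive p∧q≈⊥)) ⟩
      (b ∨ p) ∧ ¬ q       ≈⟨ a≈b⊕d ⟨
      a                   ∎
    b∧¬a≤q : b ∧ ¬ a ≤ q
    b∧¬a≤q = x∧¬y≤z⇒x∧¬z≤y (begin
      b ∧ ¬ q             ≤⟨ ∧-monotonic (x≤x∨y b p) ≤-refl ⟩
      (b ∨ p) ∧ ¬ q       ≈⟨ a≈b⊕d ⟨
      a                   ∎)

  module _ {a d : Level} (Â : ChangeAction a d) where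
    open ChangeAction Â using (Base; _⊕_)

    differenceOperator⇒derivative : ∀ _⊖_ → IsDifferenceOperator _⊖_ →
      (f : Base → Carrier) → IsDerivative Â f (λ x δ → f (x ⊕ δ) ⊖ f x)
    differenceOperator⇒derivative _⊖_ ⊖-isDifferenceOperator f x δ =
      sym (⊖-isDifferenceOperator (f (x ⊕ δ)) (f x))

open BowtieDifferences

mainTheorem9 : ∀ {c ℓ a d : Level} (L : BooleanAlgebra c ℓ) (Â : ChangeAction a d)
    (f : ChangeAction.Base Â → BooleanAlgebra.Carrier L) →
    Bowtie.IsDifferenceOperator L (Bowtie._⊖⊥_ L)
    × Bowtie.IsDifferenceOperator L (Bowtie._⊖⊤_ L)
    × Bowtie.IsDerivative L Â f (Bowtie.∂⊥ L Â f)
    × Bowtie.IsDerivative L Â f (Bowtie.∂⊤ L Â f)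
    × (∀ (g : ChangeAction.Base Â → ChangeAction.Δ Â → Bowtie.L⋈L L) →
         Bowtie.IsDerivative L Â f g →
         ∀ x δ → Bowtie._≤⋈_ L (Bowtie.∂⊥ L Â f x δ) (g x δ)
               × Bowtie._≤⋈_ L (g x δ) (Bowtie.∂⊤ L Â f x δ))
mainTheorem9 L Â f =
    ⊖⊥-isDifferenceOperator L
  , ⊖⊤-isDifferenceOperator L
  , differenceOperator⇒derivative L Â (Bowtie._⊖⊥_ L) (⊖⊥-isDifferenceOperator L) f
  , differenceOperator⇒derivative L Â (Bowtie._⊖⊤_ L) (⊖⊤-isDifferenceOperator L) f
  , λ g g-isDerivative x δ →
      ⊖⊥-least L (g x δ) (g-isDerivative x δ) , ⊖⊤-greatest L (g x δ) (g-isDerivative x δ)
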